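{- (Work complexity.) Let $\phi$ be a set of index variables, $\Phi$ a finite set of constraints on $\phi$, $\Gamma$ a context, $K$ an index and $P,Q$ processes. If $P\overset{tick}{\rightarrow}Q$ and $\phi;\Phi;\Gamma\vdash_w P\triangleleft K$, then there is an index $K'$ with $\phi;\Phi;\Gamma\vdash_w Q\triangleleft K'$ and $\phi;\Phi\vDash K'+1\le K$.
   Context: Processes. Base variables $x,y,z,\dots$ and channel names $a,b,c,\dots$; $v$ ranges over both. Expressions: $e ::= v \mid \mathtt{0} \mid \mathtt{s}(e) \mid [\,] \mid e::e' \mid \mathtt{tt} \mid \mathtt{ff}$. Processes: $P,Q ::= 0 \mid P\mid Q \mid\ !a(\vec v).P \mid a(\vec v).P \mid \overline{a}\langle \vec e\rangle \mid (\nu a)P \mid \mathtt{match}\ e\ \{\mathtt{0}\mapsto P;\ \mathtt{s}(x)\mapsto Q\} \mid \mathtt{match}\ e\ \{[\,]\mapsto P;\ x::y\mapsto Q\} \mid \mathtt{if}\ e\ \mathtt{then}\ P\ \mathtt{else}\ Q \mid \mathtt{tick}.P$, up to $\alpha$-renaming. Tick reduction $\overset{tick}{\rightarrow}$ is generated by: $\mathtt{tick}.P\overset{tick}{\rightarrow}P$; if $P\overset{tick}{\rightarrow}P'$ then $P\mid Q\overset{tick}{\rightarrow}P'\mid Q$; if $Q\overset{tick}{\rightarrow}Q'$ then $P\mid Q\overset{tick}{\rightarrow}P\mid Q'$; if $P\overset{tick}{\rightarrow}P'$ then $(\nu a)P\overset{tick}{\rightarrow}(\nu a)P'$. Indices: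 $I,J,K ::= i \mid f(I_1,\dots,I_n)$, index variables $i$ and function symbols interpreted as functions $\mathbb N^n\to\mathbb N$ (including $+$, $\cdot$, truncated subtraction). Constraints $I\bowtie J$, $\bowtie\in\{\le,<,=,\ne\}$; $\phi;\Phi\vDash C$ means every valuation satisfying $\Phi$ satisfies $C$. Work types: $\mathcal B ::= \mathsf{Nat}[I,J]\mid\mathsf{List}[I,J](\mathcal B)\mid\mathsf{Bool}$; $T ::= \mathcal B\mid\mathsf{ch}(\vec T)\mid\mathsf{in}(\vec T)\mid\mathsf{out}(\vec T)\mid\mathsf{serv}^{\forall\vec i.K}(\vec T)\mid\mathsf{iserv}^{\forall\vec i.K}(\vec T)\mid\mathsf{oserv}^{\forall\vec i.K}(\vec T)$. Subtyping $\phi;\Phi\vdash T\sqsubseteq U$: $\mathsf{Nat}[I,J]\sqsubseteq\mathsf{Nat}[I',J']$ if $\phi;\Phi\vDash I'\le I$, $J\le J'$; $\mathsf{List}[I,J](\mathcal B)\sqsubseteq\mathsf{List}[I',J'](\mathcal B')$ if moreover $\mathcal B\sqsubseteq\mathcal B'$; $\mathsf{Bool}\sqsubseteq\mathsf{Bool}$; $\mathsf{ch}(\vec T)\sqsubseteq\mathsf{ch}(\vec U)$ if $\vec T\sqsubseteq\vec U$ and $\vec U\sqsubseteq\vec T$; $\mathsf{ch}(\vec T)\sqsubseteq\mathsf{in}(\vec T)$, $\mathsf{ch}(\vec T)\sqsubseteq\mathsf{out}(\vec T)$; $\mathsf{in}(\vec T)\sqsubseteq\mathsf{in}(\vec U)$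 if $\vec T\sqsubseteq\vec U$; $\mathsf{out}(\vec T)\sqsubseteq\mathsf{out}(\vec U)$ if $\vec U\sqsubseteq\vec T$; $\mathsf{serv}^{\forall\vec i.K}(\vec T)\sqsubseteq\mathsf{serv}^{\forall\vec i.K'}(\vec U)$ if $(\phi,\vec i);\Phi\vdash\vec T\sqsubseteq\vec U$, $\vec U\sqsubseteq\vec T$, $(\phi,\vec i);\Phi\vDash K=K'$; $\mathsf{serv}^{\forall\vec i.K}(\vec T)\sqsubseteq\mathsf{iserv}^{\forall\vec i.K}(\vec T)$ and $\sqsubseteq\mathsf{oserv}^{\forall\vec i.K}(\vec T)$; $\mathsf{iserv}^{\forall\vec i.K}(\vec T)\sqsubseteq\mathsf{iserv}^{\forall\vec i.K'}(\vec U)$ if $(\phi,\vec i);\Phi\vdash\vec T\sqsubseteq\vec U$ and $(\phi,\vec i);\Phi\vDash K'\le K$; $\mathsf{oserv}^{\forall\vec i.K}(\vec T)\sqsubseteq\mathsf{oserv}^{\forall\vec i.K'}(\vec U)$ if $(\phi,\vec i);\Phi\vdash\vec U\sqsubseteq\vec T$ and $(\phi,\vec i);\Phi\vDash K\le K'$; transitivity. Contexts: pointwise. Expression typing $\phi;\Phi;\Gamma\vdash e:T$: $v:T\in\Gamma$ gives $v:T$; $\mathtt0:\mathsf{Nat}[0,0]$; $e:\mathsf{Nat}[I,J]\Rightarrow\mathtt s(e):\mathsf{Nat}[I+1,J+1]$; $[\,]:\mathsf{List}[0,0](\mathcal B)$; $e:\mathcal B$, $e':\mathsf{List}[I,J](\mathcal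 B)$ give $e::e':\mathsf{List}[I+1,J+1](\mathcal B)$; $\mathtt{tt},\mathtt{ff}:\mathsf{Bool}$; subsumption: from $\Delta\vdash e:U$, $\Gamma\sqsubseteq\Delta$, $U\sqsubseteq T$ infer $\Gamma\vdash e:T$. Work typing $\phi;\Phi;\Gamma\vdash_w P\triangleleft K$: $0\triangleleft0$; from $P\triangleleft K$ and $Q\triangleleft K'$ infer $P\mid Q\triangleleft K+K'$; from $\Gamma\vdash a:\mathsf{iserv}^{\forall\vec i.K}(\vec T)$ and $(\phi,\vec i);\Phi;\Gamma,\vec v:\vec T\vdash_w P\triangleleft K$ infer $!a(\vec v).P\triangleleft 0$; from $\Gamma\vdash a:\mathsf{in}(\vec T)$ and $\Gamma,\vec v:\vec T\vdash_w P\triangleleft K$ infer $a(\vec v).P\triangleleft K$; from $\Gamma\vdash a:\mathsf{out}(\vec T)$, $\Gamma\vdash\vec e:\vec T$ infer $\overline a\langle\vec e\rangle\triangleleft0$; from $\Gamma\vdash a:\mathsf{oserv}^{\forall\vec i.K}(\vec T)$ and $\Gamma\vdash\vec e:\vec T[\vec i:=\vec J]$ infer $\overline a\langle\vec e\rangle\triangleleft K[\vec i:=\vec J]$; from $\Gamma,a:T\vdash_w P\triangleleft K$ infer $(\nu a)P\triangleleft K$; natural-number match, list match and $\mathtt{if}$ as follows: from $\Gamma\vdash e:\mathsf{Nat}[I,J]$, $\phi;(\Phi,I\le0);\Gamma\vdash_w P\triangleleft K$, $\phi;(\Phi,J\ge1);\Gamma,x:\mathsf{Nat}[I-1,J-1]\vdash_w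 Q\triangleleft K$ infer the match $\triangleleft K$; from $\Gamma\vdash e:\mathsf{List}[I,J](\mathcal B)$, $\phi;(\Phi,I\le0);\Gamma\vdash_w P\triangleleft K$, $\phi;(\Phi,J\ge1);\Gamma,x:\mathcal B,y:\mathsf{List}[I-1,J-1](\mathcal B)\vdash_w Q\triangleleft K$ infer the match $\triangleleft K$; from $\Gamma\vdash e:\mathsf{Bool}$, $P\triangleleft K$, $Q\triangleleft K$ infer $\mathtt{if}\ e\ \mathtt{then}\ P\ \mathtt{else}\ Q\triangleleft K$; from $\Gamma\vdash_w P\triangleleft K$ infer $\mathtt{tick}.P\triangleleft K+1$; subsumption: from $\Delta\vdash_w P\triangleleft K$, $\Gamma\sqsubseteq\Delta$, $\phi;\Phi\vDash K\le K'$ infer $\Gamma\vdash_w P\triangleleft K'$. -}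

module Defs where

open import Data.Nat using (ℕ; zero; suc) renaming (_+_ to _+ℕ_; _*_ to _*ℕ_; _∸_ to _∸ℕ_; _≤_ to _≤ℕ_; _<_ to _<ℕ_)
open import Data.Fin using (Fin; _↑ˡ_; _↑ʳ_; splitAt)
open import Data.Sum using (inj₁; inj₂; [_,_]′)
open import Data.List using (List; []; _∷_; _++_; map; length)
open import Data.List.Relation.Unary.All using (All)
open import Data.List.Relation.Binary.Pointwise using (Pointwise)
open import Relation.Binary.PropositionalEquality using (_≡_)
open import Relation.Nullary using (¬_)

-- Indices, over a scope of n index variables (φ is represented by n,
-- index variables are de Bruijn variables Fin n).  A function symbol of
-- arity k is given directly by its interpretation ℕ^k → ℕ.

data Index (n : ℕ) : Set where
  ivar : Fin n → Index n
  fn   : (k : ℕ) → ((Fin k → ℕ) → ℕ) → (Fin k → Index n) → Index n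

⟦_⟧ : ∀ {n} → Index n → (Fin n → ℕ) → ℕ
⟦ ivar i ⟧ ρ = ρ i
⟦ fn k f args ⟧ ρ = f (λ j → ⟦ args j ⟧ ρ)

lit : ∀ {n} → ℕ → Index n
lit c = fn 0 (λ _ → c) (λ ())

binop : ∀ {n} → (ℕ → ℕ → ℕ) → Index n → Index n → Index n
binop op I J = fn 2 (λ v → op (v Fin.zero) (v (Fin.suc Fin.zero))) args
  where
  args : Fin 2 → Index _
  args Fin.zero = I
  args (Fin.suc Fin.zero) = J

infixl 6 _⊕_ _⊖_
infixl 7 _⊛_

_⊕_ _⊖_ _⊛_ : ∀ {n} → Index n → Index n → Index n
_⊕_ = binop _+ℕ_
_⊖_ = binop _∸ℕ_
_⊛_ = binop _*ℕ_

isub : ∀ {n n'} → (Fin n → Index n') → Index n → Index n'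
isub σ (ivar i) = σ i
isub σ (fn k f args) = fn k f (λ j → isub σ (args j))

iren : ∀ {n n'} → (Fin n → Fin n') → Index n → Index n'
iren r = isub (λ i → ivar (r i))

-- lift a substitution under m freshly bound variables (placed after the
-- existing ones: scope φ,i⃗ is n + m)
liftσ : ∀ {n n'} (m : ℕ) → (Fin n → Index n') → Fin (n +ℕ m) → Index (n' +ℕ m)
liftσ {n} {n'} m σ i = [ (λ j → iren (λ x → x ↑ˡ m) (σ j)) , (λ j → ivar (n' ↑ʳ j)) ]′ (splitAt n i)

instσ : ∀ {n} (m : ℕ) → (Fin m → Index n) → Fin (n +ℕ m) → Index n
instσ {n} m J i = [ ivar , J ]′ (splitAt n i)

wkσ : ∀ {n} (m : ℕ) → Fin n → Index (n +ℕ m)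
wkσ m i = ivar (i ↑ˡ m)

data Rel : Set where
  ≤r <r =r ≠r : Rel

record Constraint (n : ℕ) : Set where
  constructor _⟨_⟩_
  field
    lhs : Index n
    rel : Rel
    rhs : Index n

holdsRel : Rel → ℕ → ℕ → Set
holdsRel ≤r a b = a ≤ℕ b
holdsRel <r a b = a <ℕ b
holdsRel =r a b = a ≡ b
holdsRel ≠r a b = ¬ (a ≡ b)

sat : ∀ {n} → (Fin n → ℕ) → Constraint n → Set
sat ρ (I ⟨ r ⟩ J) = holdsRel r (⟦ I ⟧ ρ) (⟦ J ⟧ ρ)

_⊨_ : ∀ {n} → List (Constraint n) → Constraint n → Set
_⊨_ {n} Φ C = (ρ : Fin n → ℕ) → All (sat ρ) Φ → sat ρ C

csub : ∀ {n n'} → (Fin n → Index n') → Constraint n → Constraint n'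
csub σ (I ⟨ r ⟩ J) = isub σ I ⟨ r ⟩ isub σ J

wkΦ : ∀ {n} (m : ℕ) → List (Constraint n) → List (Constraint (n +ℕ m))
wkΦ m Φ = map (csub (wkσ m)) Φ

-- Types. serv/iserv/oserv bind m index variables (∀ i⃗, |i⃗| = m).

data BTy (n : ℕ) : Set where
  Nat  : Index n → Index n → BTy n
  Lst  : Index n → Index n → BTy n → BTy n
  Bool : BTy n

data Ty (n : ℕ) : Set where
  base  : BTy n → Ty n
  ch    : List (Ty n) → Ty n
  in'   : List (Ty n) → Ty n
  out   : List (Ty n) → Ty n
  serv  : (m : ℕ) → Index (n +ℕ m) → List (Ty (n +ℕ m)) → Ty n
  iserv : (m : ℕ) → Index (n +ℕ m) → List (Ty (n +ℕ m)) → Ty n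
  oserv : (m : ℕ) → Index (n +ℕ m) → List (Ty (n +ℕ m)) → Ty n

bsub : ∀ {n n'} → (Fin n → Index n') → BTy n → BTy n'
bsub σ (Nat I J) = Nat (isub σ I) (isub σ J)
bsub σ (Lst I J B) = Lst (isub σ I) (isub σ J) (bsub σ B)
bsub σ Bool = Bool

mutual
  tsub : ∀ {n n'} → (Fin n → Index n') → Ty n → Ty n'
  tsub σ (base B) = base (bsub σ B)
  tsub σ (ch Ts) = ch (tsubs σ Ts)
  tsub σ (in' Ts) = in' (tsubs σ Ts)
  tsub σ (out Ts) = out (tsubs σ Ts)
  tsub σ (serv m K Ts) = serv m (isub (liftσ m σ) K) (tsubs (liftσ m σ) Ts)
  tsub σ (iserv m K Ts) = iserv m (isub (liftσ m σ) K) (tsubs (liftσ m σ) Ts)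
  tsub σ (oserv m K Ts) = oserv m (isub (liftσ m σ) K) (tsubs (liftσ m σ) Ts)

  tsubs : ∀ {n n'} → (Fin n → Index n') → List (Ty n) → List (Ty n')
  tsubs σ [] = []
  tsubs σ (T ∷ Ts) = tsub σ T ∷ tsubs σ Ts

-- contexts: de Bruijn lists of types (variable 0 is the most recent)
Ctx : ℕ → Set
Ctx n = List (Ty n)

wkΓ : ∀ {n} (m : ℕ) → Ctx n → Ctx (n +ℕ m)
wkΓ m Γ = tsubs (wkσ m) Γ

data _∋_∶_ {A : Set} : List A → ℕ → A → Set where
  here  : ∀ {x xs} → (x ∷ xs) ∋ 0 ∶ x
  there : ∀ {y xs k x} → xs ∋ k ∶ x → (y ∷ xs) ∋ suc k ∶ x

infix 4 _⊢_⊑_ _⊢_⊑*_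

data _⊢_⊑_ : ∀ {n} → List (Constraint n) → Ty n → Ty n → Set where
  ⊑nat  : ∀ {n} {Φ : List (Constraint n)} {I J I' J'} →
          Φ ⊨ (I' ⟨ ≤r ⟩ I) → Φ ⊨ (J ⟨ ≤r ⟩ J') →
          Φ ⊢ base (Nat I J) ⊑ base (Nat I' J')
  ⊑list : ∀ {n} {Φ : List (Constraint n)} {I J I' J' B B'} →
          Φ ⊨ (I' ⟨ ≤r ⟩ I) → Φ ⊨ (J ⟨ ≤r ⟩ J') → Φ ⊢ base B ⊑ base B' →
          Φ ⊢ base (Lst I J B) ⊑ base (Lst I' J' B')
  ⊑bool : ∀ {n} {Φ : List (Constraint n)} → Φ ⊢ base Bool ⊑ base Bool
  ⊑ch   : ∀ {n} {Φ : List (Constraint n)} {Ts Us} →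
          Pointwise (Φ ⊢_⊑_) Ts Us → Pointwise (Φ ⊢_⊑_) Us Ts →
          Φ ⊢ ch Ts ⊑ ch Us
  ⊑ch-in  : ∀ {n} {Φ : List (Constraint n)} {Ts} → Φ ⊢ ch Ts ⊑ in' Ts
  ⊑ch-out : ∀ {n} {Φ : List (Constraint n)} {Ts} → Φ ⊢ ch Ts ⊑ out Ts
  ⊑in   : ∀ {n} {Φ : List (Constraint n)} {Ts Us} →
          Pointwise (Φ ⊢_⊑_) Ts Us → Φ ⊢ in' Ts ⊑ in' Us
  ⊑out  : ∀ {n} {Φ : List (Constraint n)} {Ts Us} →
          Pointwise (Φ ⊢_⊑_) Us Ts → Φ ⊢ out Ts ⊑ out Us
  ⊑serv : ∀ {n} {Φ : List (Constraint n)} {m K K' Ts Us} →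
          Pointwise (wkΦ m Φ ⊢_⊑_) Ts Us → Pointwise (wkΦ m Φ ⊢_⊑_) Us Ts →
          wkΦ m Φ ⊨ (K ⟨ =r ⟩ K') →
          Φ ⊢ serv m K Ts ⊑ serv m K' Us
  ⊑serv-iserv : ∀ {n} {Φ : List (Constraint n)} {m K Ts} → Φ ⊢ serv m K Ts ⊑ iserv m K Ts
  ⊑serv-oserv : ∀ {n} {Φ : List (Constraint n)} {m K Ts} → Φ ⊢ serv m K Ts ⊑ oserv m K Ts
  ⊑iserv : ∀ {n} {Φ : List (Constraint n)} {m K K' Ts Us} →
          Pointwise (wkΦ m Φ ⊢_⊑_) Ts Us → wkΦ m Φ ⊨ (K' ⟨ ≤r ⟩ K) →
          Φ ⊢ iserv m K Ts ⊑ iserv m K' Us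
  ⊑oserv : ∀ {n} {Φ : List (Constraint n)} {m K K' Ts Us} →
          Pointwise (wkΦ m Φ ⊢_⊑_) Us Ts → wkΦ m Φ ⊨ (K ⟨ ≤r ⟩ K') →
          Φ ⊢ oserv m K Ts ⊑ oserv m K' Us
  ⊑trans : ∀ {n} {Φ : List (Constraint n)} {T U V} →
          Φ ⊢ T ⊑ U → Φ ⊢ U ⊑ V → Φ ⊢ T ⊑ V

_⊢_⊑*_ : ∀ {n} → List (Constraint n) → Ctx n → Ctx n → Set
Φ ⊢ Γ ⊑* Δ = Pointwise (Φ ⊢_⊑_) Γ Δ

-- Expressions and processes (de Bruijn variables ℕ; base variables and
-- channel names share one namespace).  A binder of k names makes the
-- bound names 0..k-1 (in order), outer names are shifted by k.

data Expr : Set where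
  var  : ℕ → Expr
  zeroE : Expr
  sucE : Expr → Expr
  nilE : Expr
  consE : Expr → Expr → Expr
  tt ff : Expr

data Proc : Set where
  𝟘       : Proc
  _∣_      : Proc → Proc → Proc
  !inp     : (a : ℕ) → (arity : ℕ) → Proc → Proc
  inp      : (a : ℕ) → (arity : ℕ) → Proc → Proc
  outp     : (a : ℕ) → List Expr → Proc
  ν        : Proc → Proc
  matchNat : Expr → Proc → Proc → Proc             -- s(x) ↦ Q binds x
  matchList : Expr → Proc → Proc → Proc            -- x::y ↦ Q binds x (0), y (1)
  ifte     : Expr → Proc → Proc → Proc
  tick     : Proc → Proc

infix 4 _⟶tick_

data _⟶tick_ : Proc → Proc → Set where
  tick-top : ∀ {P} → tick P ⟶tick P
  tick-parL : ∀ {P P' Q} → P ⟶tick P' → (P ∣ Q) ⟶tick (P' ∣ Q)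
  tick-parR : ∀ {P Q Q'} → Q ⟶tick Q' → (P ∣ Q) ⟶tick (P ∣ Q')
  tick-ν : ∀ {P P'} → P ⟶tick P' → ν P ⟶tick ν P'

infix 4 _∣_⊢e_∶_ _∣_⊢w_◁_

data _∣_⊢e_∶_ : ∀ {n} → List (Constraint n) → Ctx n → Expr → Ty n → Set where
  tvar  : ∀ {n} {Φ : List (Constraint n)} {Γ x T} → Γ ∋ x ∶ T → Φ ∣ Γ ⊢e var x ∶ T
  tzero : ∀ {n} {Φ : List (Constraint n)} {Γ} → Φ ∣ Γ ⊢e zeroE ∶ base (Nat (lit 0) (lit 0))
  tsuc  : ∀ {n} {Φ : List (Constraint n)} {Γ e I J} →
          Φ ∣ Γ ⊢e e ∶ base (Nat I J) →
          Φ ∣ Γ ⊢e sucE e ∶ base (Nat (I ⊕ lit 1) (J ⊕ lit 1))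
  tnil  : ∀ {n} {Φ : List (Constraint n)} {Γ B} → Φ ∣ Γ ⊢e nilE ∶ base (Lst (lit 0) (lit 0) B)
  tcons : ∀ {n} {Φ : List (Constraint n)} {Γ e e' B I J} →
          Φ ∣ Γ ⊢e e ∶ base B → Φ ∣ Γ ⊢e e' ∶ base (Lst I J B) →
          Φ ∣ Γ ⊢e consE e e' ∶ base (Lst (I ⊕ lit 1) (J ⊕ lit 1) B)
  ttt   : ∀ {n} {Φ : List (Constraint n)} {Γ} → Φ ∣ Γ ⊢e tt ∶ base Bool
  tff   : ∀ {n} {Φ : List (Constraint n)} {Γ} → Φ ∣ Γ ⊢e ff ∶ base Bool
  tsubsum : ∀ {n} {Φ : List (Constraint n)} {Γ Δ e T U} →
          Φ ∣ Δ ⊢e e ∶ U → Φ ⊢ Γ ⊑* Δ → Φ ⊢ U ⊑ T → Φ ∣ Γ ⊢e e ∶ T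

_∣_⊢es_∶_ : ∀ {n} → List (Constraint n) → Ctx n → List Expr → List (Ty n) → Set
Φ ∣ Γ ⊢es es ∶ Ts = Pointwise (λ e T → Φ ∣ Γ ⊢e e ∶ T) es Ts

data _∣_⊢w_◁_ : ∀ {n} → List (Constraint n) → Ctx n → Proc → Index n → Set where
  w𝟘    : ∀ {n} {Φ : List (Constraint n)} {Γ} → Φ ∣ Γ ⊢w 𝟘 ◁ lit 0
  wpar  : ∀ {n} {Φ : List (Constraint n)} {Γ P Q K K'} →
          Φ ∣ Γ ⊢w P ◁ K → Φ ∣ Γ ⊢w Q ◁ K' → Φ ∣ Γ ⊢w (P ∣ Q) ◁ (K ⊕ K')
  wrep  : ∀ {n} {Φ : List (Constraint n)} {Γ a k P m K Ts} →
          Φ ∣ Γ ⊢e var a ∶ iserv m K Ts → length Ts ≡ k →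
          wkΦ m Φ ∣ Ts ++ wkΓ m Γ ⊢w P ◁ K →
          Φ ∣ Γ ⊢w !inp a k P ◁ lit 0
  winp  : ∀ {n} {Φ : List (Constraint n)} {Γ a k P K Ts} →
          Φ ∣ Γ ⊢e var a ∶ in' Ts → length Ts ≡ k →
          Φ ∣ Ts ++ Γ ⊢w P ◁ K →
          Φ ∣ Γ ⊢w inp a k P ◁ K
  wout  : ∀ {n} {Φ : List (Constraint n)} {Γ a es Ts} →
          Φ ∣ Γ ⊢e var a ∶ out Ts → Φ ∣ Γ ⊢es es ∶ Ts →
          Φ ∣ Γ ⊢w outp a es ◁ lit 0
  woserv : ∀ {n} {Φ : List (Constraint n)} {Γ a es m K Ts} →
          Φ ∣ Γ ⊢e var a ∶ oserv m K Ts → (J : Fin m → Index n) →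
          Φ ∣ Γ ⊢es es ∶ tsubs (instσ m J) Ts →
          Φ ∣ Γ ⊢w outp a es ◁ isub (instσ m J) K
  wν    : ∀ {n} {Φ : List (Constraint n)} {Γ P K} (T : Ty n) →
          Φ ∣ T ∷ Γ ⊢w P ◁ K → Φ ∣ Γ ⊢w ν P ◁ K
  wmatchNat : ∀ {n} {Φ : List (Constraint n)} {Γ e P Q I J K} →
          Φ ∣ Γ ⊢e e ∶ base (Nat I J) →
          (I ⟨ ≤r ⟩ lit 0) ∷ Φ ∣ Γ ⊢w P ◁ K →
          (lit 1 ⟨ ≤r ⟩ J) ∷ Φ ∣ base (Nat (I ⊖ lit 1) (J ⊖ lit 1)) ∷ Γ ⊢w Q ◁ K →
          Φ ∣ Γ ⊢w matchNat e P Q ◁ K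
  wmatchList : ∀ {n} {Φ : List (Constraint n)} {Γ e P Q I J B K} →
          Φ ∣ Γ ⊢e e ∶ base (Lst I J B) →
          (I ⟨ ≤r ⟩ lit 0) ∷ Φ ∣ Γ ⊢w P ◁ K →
          (lit 1 ⟨ ≤r ⟩ J) ∷ Φ ∣ base B ∷ base (Lst (I ⊖ lit 1) (J ⊖ lit 1) B) ∷ Γ ⊢w Q ◁ K →
          Φ ∣ Γ ⊢w matchList e P Q ◁ K
  wif   : ∀ {n} {Φ : List (Constraint n)} {Γ e P Q K} →
          Φ ∣ Γ ⊢e e ∶ base Bool → Φ ∣ Γ ⊢w P ◁ K → Φ ∣ Γ ⊢w Q ◁ K →
          Φ ∣ Γ ⊢w ifte e P Q ◁ K
  wtick : ∀ {n} {Φ : List (Constraint n)} {Γ P K} →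
          Φ ∣ Γ ⊢w P ◁ K → Φ ∣ Γ ⊢w tick P ◁ (K ⊕ lit 1)
  wsub  : ∀ {n} {Φ : List (Constraint n)} {Γ Δ P K K'} →
          Φ ∣ Δ ⊢w P ◁ K → Φ ⊢ Γ ⊑* Δ → Φ ⊨ (K ⟨ ≤r ⟩ K') →
          Φ ∣ Γ ⊢w P ◁ K'

module Submission where

open import Defs
open import Data.Nat using (ℕ; _+_; _≤_)
open import Data.Nat.Properties using (≤-refl; ≤-trans; +-assoc; +-comm; +-monoˡ-≤; +-monoʳ-≤; module ≤-Reasoning)
open import Data.List using (List)
open import Data.Product using (Σ; _×_; _,_)
open import Relation.Binary.PropositionalEquality using (cong)

⊨-≤-refl : ∀ {n} {Φ : List (Constraint n)} (K : Index n) → Φ ⊨ (K ⟨ ≤r ⟩ K)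
⊨-≤-refl K ρ _ = ≤-refl

+1-monoˡ-≤ : ∀ {a c} b → a + 1 ≤ c → a + b + 1 ≤ c + b
+1-monoˡ-≤ {a} {c} b a+1≤c = begin
  a + b + 1   ≡⟨ +-assoc a b 1 ⟩
  a + (b + 1) ≡⟨ cong (a +_) (+-comm b 1) ⟩
  a + (1 + b) ≡⟨ +-assoc a 1 b ⟨
  a + 1 + b   ≤⟨ +-monoˡ-≤ b a+1≤c ⟩
  c + b       ∎
  where open ≤-Reasoning

+1-monoʳ-≤ : ∀ a {b c} → b + 1 ≤ c → a + b + 1 ≤ a + c
+1-monoʳ-≤ a {b} {c} b+1≤c = begin
  a + b + 1   ≡⟨ +-assoc a b 1 ⟩
  a + (b + 1) ≤⟨ +-monoʳ-≤ a b+1≤c ⟩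
  a + c       ∎
  where open ≤-Reasoning

WorkDecreases : ∀ {n} → List (Constraint n) → Ctx n → Proc → Index n → Set
WorkDecreases {n} Φ Γ Q K = Σ (Index n) (λ K' → (Φ ∣ Γ ⊢w Q ◁ K') × (Φ ⊨ ((K' ⊕ lit 1) ⟨ ≤r ⟩ K)))

tick-decreases-work : ∀ {n} {Φ : List (Constraint n)} {Γ P Q K} →
                      P ⟶tick Q → Φ ∣ Γ ⊢w P ◁ K → WorkDecreases Φ Γ Q K
tick-decreases-work tick-top (wtick {K = K} ⊢P) = K , ⊢P , ⊨-≤-refl (K ⊕ lit 1)
tick-decreases-work (tick-parL P⟶P') (wpar {K' = L} ⊢P ⊢Q)
  with K' , ⊢P' , K'+1≤K ← tick-decreases-work P⟶P' ⊢P
  = K' ⊕ L , wpar ⊢P' ⊢Q , λ ρ Φρ → +1-monoˡ-≤ (⟦ L ⟧ ρ) (K'+1≤K ρ Φρ)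
tick-decreases-work (tick-parR Q⟶Q') (wpar {K = L} ⊢P ⊢Q)
  with K' , ⊢Q' , K'+1≤K ← tick-decreases-work Q⟶Q' ⊢Q
  = L ⊕ K' , wpar ⊢P ⊢Q' , λ ρ Φρ → +1-monoʳ-≤ (⟦ L ⟧ ρ) (K'+1≤K ρ Φρ)
tick-decreases-work (tick-ν P⟶P') (wν T ⊢P)
  with K' , ⊢P' , K'+1≤K ← tick-decreases-work P⟶P' ⊢P
  = K' , wν T ⊢P' , K'+1≤K
tick-decreases-work P⟶Q (wsub ⊢P Γ⊑Δ K≤L)
  with K' , ⊢Q , K'+1≤K ← tick-decreases-work P⟶Q ⊢P
  = K' , wsub ⊢Q Γ⊑Δ (⊨-≤-refl K') , λ ρ Φρ → ≤-trans (K'+1≤K ρ Φρ) (K≤L ρ Φρ)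

mainTheorem2 : ∀ {n : ℕ} (Φ : List (Constraint n)) (Γ : Ctx n) (K : Index n) (P Q : Proc) →
    P ⟶tick Q → Φ ∣ Γ ⊢w P ◁ K →
    Σ (Index n) (λ K' → (Φ ∣ Γ ⊢w Q ◁ K') × (Φ ⊨ ((K' ⊕ lit 1) ⟨ ≤r ⟩ K)))
mainTheorem2 Φ Γ K P Q = tick-decreases-work
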